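{- (Intuitionistic logic.) For all $a,b\in\mathbb Q$, every type $A$ and all families $q,r:A\to\mathbb Q$, CovL holds if and only if CovU holds.
   Context: Intuitionistic logic with an impredicative type of propositions. A lowercut is $L\subseteq\mathbb Q$ that is a lower set ($a<b\wedge b\in L\to a\in L$) and upwards-open ($a\in L\to\exists b,(a<b\wedge b\in L)$); an uppercut is $U\subseteq\mathbb Q$ that is an upper set ($a<b\wedge a\in U\to b\in U$) and downwards-open ($b\in U\to\exists a,(a<b\wedge a\in U)$). $\overline L:=\{q\mid\forall r,(r<q\to r\in L)\}$, $\overline U:=\{q\mid\forall r,(q<r\to r\in U)\}$. CovL: for every lowercut $L$, if $q_\alpha\in L\to r_\alpha\in\overline L$ for all $\alpha:A$, then $a\in\overline L\to b\in L$. CovU: for every uppercut $U$, if $r_\alpha\in U\to q_\alpha\in\overline U$ for all $\alpha:A$, then $b\in\overline U\to a\in U$. -}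

module Defs where

open import Level using (Level; _⊔_; suc)
open import Data.Rational using (ℚ; _<_)
open import Data.Product using (Σ; _×_)

Subset : (ℓ : Level) → Set (suc ℓ)
Subset ℓ = ℚ → Set ℓ

record IsLowercut {ℓ : Level} (L : Subset ℓ) : Set ℓ where
  field
    lower      : ∀ a b → a < b → L b → L a
    upwardOpen : ∀ a → L a → Σ ℚ (λ b → a < b × L b)

record IsUppercut {ℓ : Level} (U : Subset ℓ) : Set ℓ where
  field
    upper        : ∀ a b → a < b → U a → U b
    downwardOpen : ∀ b → U b → Σ ℚ (λ a → a < b × U a)

closureL : {ℓ : Level} → Subset ℓ → Subset ℓ
closureL L q = ∀ r → r < q → L r

closureU : {ℓ : Level} → Subset ℓ → Subset ℓ
closureU U q = ∀ r → q < r → U r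

CovL : {α : Level} (ℓ : Level) (a b : ℚ) (A : Set α) (q r : A → ℚ) → Set (α ⊔ suc ℓ)
CovL ℓ a b A q r =
  (L : Subset ℓ) → IsLowercut L →
  (∀ (x : A) → L (q x) → closureL L (r x)) →
  closureL L a → L b

CovU : {α : Level} (ℓ : Level) (a b : ℚ) (A : Set α) (q r : A → ℚ) → Set (α ⊔ suc ℓ)
CovU ℓ a b A q r =
  (U : Subset ℓ) → IsUppercut U →
  (∀ (x : A) → U (r x) → closureU U (q x)) →
  closureU U b → U a

{-# OPTIONS --safe #-}
module Submission where

-- Given an uppercut U, the set L of those s for which some s' > s satisfies
-- s' ∈ U → a ∈ U is a lowercut (for any U, by transitivity and density of ℚ).
-- The covering hypotheses for U become those for L, a ∈ L̄ holds trivially, and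
-- b ∈ L together with b ∈ Ū yields a ∈ U; the converse is the mirror image.
-- Neither direction uses that the given set is a cut.

open import Defs
open import Level using (Level)
open import Data.Rational using (ℚ; _<_)
open import Data.Rational.Properties using (<-dense; <-trans)
open import Data.Product using (Σ; _×_; _,_)
open import Function using (id)
open import Function.Bundles using (_⇔_; mk⇔)

module _ {ℓ : Level} (V : Subset ℓ) (P : Set ℓ) where

  implyingLowercut : Subset ℓ
  implyingLowercut s = Σ ℚ λ s′ → s < s′ × (V s′ → P)

  implyingLowercut-isLowercut : IsLowercut implyingLowercut
  implyingLowercut-isLowercut = record
    { lower      = λ { t s t<s (s′ , s<s′ , f) → s′ , <-trans t<s s<s′ , f }
    ; upwardOpen = λ { s (s′ , s<s′ , f) → let m , s<m , m<s′ = <-dense s<s′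
                                           in m , s<m , s′ , m<s′ , f }
    }

  implyingLowercut-closure : ∀ {s} → (V s → P) → closureL implyingLowercut s
  implyingLowercut-closure {s} f t t<s = s , t<s , f

  implyingLowercut-transfer : ∀ {u v} → (V v → closureU V u) →
                              implyingLowercut u → closureL implyingLowercut v
  implyingLowercut-transfer {v = v} hyp (s′ , u<s′ , f) t t<v =
    v , t<v , λ Vv → f (hyp Vv s′ u<s′)

  implyingLowercut-elim : ∀ {s} → closureU V s → implyingLowercut s → P
  implyingLowercut-elim s∈V̄ (s′ , s<s′ , f) = f (s∈V̄ s′ s<s′)

  implyingUppercut : Subset ℓ
  implyingUppercut s = Σ ℚ λ s′ → s′ < s × (V s′ → P)

  implyingUppercut-isUppercut : IsUppercut implyingUppercut
  implyingUppercut-isUppercut = record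
    { upper        = λ { s t s<t (s′ , s′<s , f) → s′ , <-trans s′<s s<t , f }
    ; downwardOpen = λ { s (s′ , s′<s , f) → let m , s′<m , m<s = <-dense s′<s
                                             in m , m<s , s′ , s′<m , f }
    }

  implyingUppercut-closure : ∀ {s} → (V s → P) → closureU implyingUppercut s
  implyingUppercut-closure {s} f t s<t = s , s<t , f

  implyingUppercut-transfer : ∀ {u v} → (V v → closureL V u) →
                              implyingUppercut u → closureU implyingUppercut v
  implyingUppercut-transfer {v = v} hyp (s′ , s′<u , f) t v<t =
    v , v<t , λ Vv → f (hyp Vv s′ s′<u)

  implyingUppercut-elim : ∀ {s} → closureL V s → implyingUppercut s → P
  implyingUppercut-elim s∈V̄ (s′ , s′<s , f) = f (s∈V̄ s′ s′<s)

module _ {α ℓ : Level} {a b : ℚ} {A : Set α} {q r : A → ℚ} where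

  CovL⇒CovU : CovL ℓ a b A q r → CovU ℓ a b A q r
  CovL⇒CovU covL U _ hyp b∈Ū = implyingLowercut-elim U (U a) b∈Ū
    (covL (implyingLowercut U (U a)) (implyingLowercut-isLowercut U (U a))
          (λ x → implyingLowercut-transfer U (U a) (hyp x))
          (implyingLowercut-closure U (U a) id))

  CovU⇒CovL : CovU ℓ a b A q r → CovL ℓ a b A q r
  CovU⇒CovL covU L _ hyp a∈L̄ = implyingUppercut-elim L (L b) a∈L̄
    (covU (implyingUppercut L (L b)) (implyingUppercut-isUppercut L (L b))
          (λ x → implyingUppercut-transfer L (L b) (hyp x))
          (implyingUppercut-closure L (L b) id))

corollary39 : {α : Level} (ℓ : Level) (a b : ℚ) (A : Set α) (q r : A → ℚ) →
    CovL ℓ a b A q r ⇔ CovU ℓ a b A q r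
corollary39 ℓ a b A q r = mk⇔ CovL⇒CovU CovU⇒CovL
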